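{- Every $t$-perturbation of a graph $G$ is locally equivalent to a rank-$2t$ perturbation of $G$.
   Context: For a graph $G$, $A(G)$ is its adjacency matrix over $\mathrm{GF}(2)$. A graph $G_1$ is a rank-$s$ perturbation of a graph $G_2$ (on the same vertex set) if $A(G_1)$ can be obtained from $A(G_2)$ by adding (over $\mathrm{GF}(2)$) a matrix of rank at most $s$ and then changing all diagonal entries to $0$. Local complementation at $v$ replaces the induced subgraph on $N_G(v)$ by its complement; two graphs are locally equivalent if one is obtained from the other by a sequence of local complementations; a vertex-minor of $G$ is an induced subgraph of a graph locally equivalent to $G$. $G_1$ is a $t$-perturbation of $G_2$ if $V(G_1)=V(G_2)$ and some graph on $|V(G_1)|+t$ vertices contains both as vertex-minors. -}

module Defs where

open import Data.Nat using (ℕ; zero; suc; _+_; _*_)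
open import Data.Fin using (Fin; _≟_)
import Data.Fin as F
open import Data.Bool using (Bool; true; false; _xor_; _∧_; if_then_else_)
open import Data.Bool.Properties using (∧-comm)
open import Data.List using (List; foldl)
open import Data.Product using (Σ; ∃; ∃-syntax; _×_; _,_)
open import Relation.Nullary using (¬_; yes; no)
open import Relation.Nullary.Decidable using (⌊_⌋)
open import Relation.Binary.PropositionalEquality using (_≡_; refl; sym)
open import Function.Definitions using (Injective)

-- A (finite, simple, labelled) graph on the vertex set Fin n, given by its
-- adjacency matrix over GF(2) = Bool (xor is addition, ∧ multiplication).
record Graph (n : ℕ) : Set where
  field
    adj   : Fin n → Fin n → Bool
    symm  : ∀ x y → adj x y ≡ adj y x
    irrefl : ∀ x → adj x x ≡ false
open Graph public

⊕-sum : ∀ {s} → (Fin s → Bool) → Bool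
⊕-sum {zero}  f = false
⊕-sum {suc s} f = f F.zero xor ⊕-sum (λ k → f (F.suc k))

RankAtMost : ∀ {n} → ℕ → (Fin n → Fin n → Bool) → Set
RankAtMost {n} s M =
  Σ (Fin n → Fin s → Bool) λ U → Σ (Fin s → Fin n → Bool) λ W →
    (∀ i j → M i j ≡ ⊕-sum {s} (λ k → U i k ∧ W k j))

-- G₁ is a rank-s perturbation of G₂: A(G₁) = A(G₂) + M off the diagonal,
-- for some M of rank ≤ s (the diagonal of both is 0 anyway).
RankPerturbation : ∀ {n} → ℕ → Graph n → Graph n → Set
RankPerturbation {n} s G₁ G₂ =
  Σ (Fin n → Fin n → Bool) λ M → RankAtMost s M ×
    (∀ i j → ¬ i ≡ j → adj G₁ i j ≡ (adj G₂ i j xor M i j))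

lcAdj : ∀ {n} → Graph n → Fin n → Fin n → Fin n → Bool
lcAdj G v x y = if ⌊ x ≟ y ⌋ then false
                else (adj G x y xor (adj G v x ∧ adj G v y))

private
  lc-symm : ∀ {n} (G : Graph n) v x y → lcAdj G v x y ≡ lcAdj G v y x
  lc-symm G v x y with x ≟ y | y ≟ x
  ... | yes _ | yes _ = refl
  ... | yes p | no ¬q = Data.Empty.⊥-elim (¬q (sym p))
    where import Data.Empty
  ... | no ¬p | yes q = Data.Empty.⊥-elim (¬p (sym q))
    where import Data.Empty
  ... | no _ | no _ rewrite symm G x y | ∧-comm (adj G v x) (adj G v y) = refl

  lc-irrefl : ∀ {n} (G : Graph n) v x → lcAdj G v x x ≡ false
  lc-irrefl G v x with x ≟ x
  ... | yes _ = refl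
  ... | no ¬p = Data.Empty.⊥-elim (¬p refl)
    where import Data.Empty

localComplement : ∀ {n} → Graph n → Fin n → Graph n
localComplement G v = record
  { adj = lcAdj G v ; symm = lc-symm G v ; irrefl = lc-irrefl G v }

localComplements : ∀ {n} → Graph n → List (Fin n) → Graph n
localComplements = foldl localComplement

_≈G_ : ∀ {n} → Graph n → Graph n → Set
G ≈G H = ∀ x y → adj G x y ≡ adj H x y

LocallyEquivalent : ∀ {n} → Graph n → Graph n → Set
LocallyEquivalent {n} G H = Σ (List (Fin n)) λ vs → (localComplements G vs ≈G H)

InducedVia : ∀ {n m} → (Fin n → Fin m) → Graph n → Graph m → Set
InducedVia f G H = ∀ x y → adj G x y ≡ adj H (f x) (f y)

VertexMinorVia : ∀ {n m} → (Fin n → Fin m) → Graph n → Graph m → Set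
VertexMinorVia {n} {m} f G H =
  Σ (Graph m) λ H' → (LocallyEquivalent H H' × InducedVia f G H')

TPerturbation : ∀ {n} → ℕ → Graph n → Graph n → Set
TPerturbation {n} t G₁ G₂ =
  Σ (Graph (n + t)) λ H → Σ (Fin n → Fin (n + t)) λ f →
    Injective _≡_ _≡_ f × VertexMinorVia f G₁ H × VertexMinorVia f G₂ H

{-# OPTIONS --safe #-}
-- Let K be the graph, locally equivalent to H, of which G₁ is an induced subgraph; then
-- G is an induced subgraph of K ⋆ σ for some σ.  By Bouchet's lemma, for every σ and
-- every vertex v there is a sequence ρ avoiding v such that, away from v, K ⋆ ρ is K ⋆ σ
-- followed by nothing, by a local complementation at v, or by a pivot v w v along an
-- edge vw; away from v each of these changes the adjacency matrix by a matrix of rank at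
-- most 2.  Eliminating the at most t vertices of H outside G one after another yields a
-- sequence τ in V(G) with A(K ⋆ τ) = A(K ⋆ σ) + M on V(G) and rank M ≤ 2t, and as τ lies
-- in V(G), K ⋆ τ restricts to G₁ ⋆ τ.
--
-- The identities between short words of local complementations used in Bouchet's lemma,
-- and the rank-2 formula for a pivot, only involve the two or three complemented vertices
-- and the two compared ones, so they are verified by evaluating both sides on every
-- configuration of these vertices.

module Submission where

open import Defs
open import Data.Nat using (ℕ; zero; suc; _+_; _*_; _≤_)
open import Data.Nat.Properties using (m≤n⇒∃[o]m+o≡n; *-suc; *-monoʳ-≤; +-cancelˡ-≤)
open import Data.Bool using (Bool; true; false; _xor_; _∧_; T)
open import Data.Bool.Properties using (xor-assoc; xor-comm; xor-same; xor-identityʳ; T-∧)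
  renaming (_≟_ to _≟ᵇ_)
open import Data.Fin using (Fin; zero; suc; _≟_; #_; _↑ˡ_; _↑ʳ_)
open import Data.Fin.Properties using (any?; injective⇒≤)
open import Data.List
  using (List; []; _∷_; _++_; [_]; map; foldl; reverse; length; lookup; filter; tabulate; allFin)
open import Data.List.Properties using (foldl-++; unfold-reverse; length-++; length-tabulate)
open import Data.List.Membership.Propositional using (_∈_; _∉_)
open import Data.List.Membership.Propositional.Properties
  using (∈-lookup; ∈-filter⁺; ∈-filter⁻; ∈-allFin; ∈-tabulate⁻)
open import Data.List.Relation.Unary.All as All using (All; []; _∷_; all?)
open import Data.List.Relation.Unary.All.Properties using (++⁺)
open import Data.List.Relation.Unary.AllPairs using (_∷_)
open import Data.List.Relation.Unary.Any using (here; there)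
open import Data.List.Relation.Unary.Unique.Propositional using (Unique)
import Data.List.Relation.Unary.Unique.Propositional.Properties as Unique
open import Data.Product using (Σ-syntax; ∃-syntax; _×_; _,_; proj₁; proj₂)
open import Data.Sum using (_⊎_; inj₁; inj₂)
open import Data.Unit using (tt)
open import Data.Vec.Functional using (Vector; tail)
  renaming ([] to []ᵛ; _∷_ to _∷ᵛ_; _++_ to _++ᵛ_)
open import Data.Vec.Functional.Properties using (lookup-++ˡ; lookup-++ʳ)
open import Function using (_∘_)
open import Function.Bundles using (Equivalence)
open import Function.Definitions using (Injective)
open import Relation.Nullary using (¬_; Dec; does; yes; no; contradiction; ¬?)
open import Relation.Nullary.Decidable
  using (⌊_⌋; dec-false; toWitness; _×-dec_; _→-dec_)
open import Relation.Binary.PropositionalEquality hiding ([_])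

private
  variable
    a b k m n s : ℕ

-- Local complementation

infixl 30 _*ₗ_ _⋆_

_*ₗ_ : Graph n → Fin n → Graph n
_*ₗ_ = localComplement

_⋆_ : Graph n → List (Fin n) → Graph n
_⋆_ = localComplements

lc-off-diagonal : ∀ (G : Graph n) v {x y} → x ≢ y →
  adj (G *ₗ v) x y ≡ adj G x y xor (adj G v x ∧ adj G v y)
lc-off-diagonal G v {x} {y} x≢y with x ≟ y
... | yes x≡y = contradiction x≡y x≢y
... | no _    = refl

lc-row : ∀ (G : Graph n) v x → adj (G *ₗ v) v x ≡ adj G v x
lc-row G v x with v ≟ x
... | yes refl = sym (irrefl G v)
... | no _ rewrite irrefl G v = xor-identityʳ _

lc-nonneighbour : ∀ (G : Graph n) {u x y} → adj G x u ≡ false → x ≢ y →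
  adj (G *ₗ u) x y ≡ adj G x y
lc-nonneighbour G {u} {x} {y} xu x≢y
  rewrite lc-off-diagonal G u x≢y | symm G u x | xu = xor-identityʳ (adj G x y)

≈G-offDiagonal : ∀ {G H : Graph n} → (∀ {x y} → x ≢ y → adj G x y ≡ adj H x y) → G ≈G H
≈G-offDiagonal {G = G} {H} G≈H x y with x ≟ y
... | yes refl = trans (irrefl G x) (sym (irrefl H x))
... | no x≢y   = G≈H x≢y

lc-involutive : ∀ (G : Graph n) v → G *ₗ v *ₗ v ≈G G
lc-involutive G v = ≈G-offDiagonal {G = G *ₗ v *ₗ v} {G} λ {x} {y} x≢y → begin
  adj (G *ₗ v *ₗ v) x y
    ≡⟨ lc-off-diagonal (G *ₗ v) v x≢y ⟩
  adj (G *ₗ v) x y xor (adj (G *ₗ v) v x ∧ adj (G *ₗ v) v y)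
    ≡⟨ cong₂ (λ a b → adj (G *ₗ v) x y xor (a ∧ b)) (lc-row G v x) (lc-row G v y) ⟩
  adj (G *ₗ v) x y xor (adj G v x ∧ adj G v y)
    ≡⟨ cong (_xor (adj G v x ∧ adj G v y)) (lc-off-diagonal G v x≢y) ⟩
  (adj G x y xor (adj G v x ∧ adj G v y)) xor (adj G v x ∧ adj G v y)
    ≡⟨ xor-assoc (adj G x y) _ _ ⟩
  adj G x y xor ((adj G v x ∧ adj G v y) xor (adj G v x ∧ adj G v y))
    ≡⟨ cong (adj G x y xor_) (xor-same (adj G v x ∧ adj G v y)) ⟩
  adj G x y xor false
    ≡⟨ xor-identityʳ _ ⟩
  adj G x y ∎
  where open ≡-Reasoning

lc-cong : ∀ {G H : Graph n} v → G ≈G H → G *ₗ v ≈G H *ₗ v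
lc-cong v G≈H x y with x ≟ y
... | yes _ = refl
... | no _ = cong₂ _xor_ (G≈H x y) (cong₂ _∧_ (G≈H v x) (G≈H v y))

⋆-cong : ∀ {G H : Graph n} vs → G ≈G H → G ⋆ vs ≈G H ⋆ vs
⋆-cong []       G≈H = G≈H
⋆-cong {G = G} {H} (v ∷ vs) G≈H = ⋆-cong vs (lc-cong {G = G} {H} v G≈H)

⋆-++ : ∀ (G : Graph n) us vs → G ⋆ (us ++ vs) ≡ G ⋆ us ⋆ vs
⋆-++ = foldl-++ localComplement

⋆-reverse-inverse : ∀ (G : Graph n) vs → G ⋆ vs ⋆ reverse vs ≈G G
⋆-reverse-inverse G []       x y = refl
⋆-reverse-inverse G (v ∷ vs) x y = begin
  adj (G *ₗ v ⋆ vs ⋆ reverse (v ∷ vs)) x y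
    ≡⟨ cong (λ us → adj (G *ₗ v ⋆ vs ⋆ us) x y) (unfold-reverse v vs) ⟩
  adj (G *ₗ v ⋆ vs ⋆ (reverse vs ++ [ v ])) x y
    ≡⟨ cong (λ K → adj K x y) (⋆-++ (G *ₗ v ⋆ vs) (reverse vs) [ v ]) ⟩
  adj (G *ₗ v ⋆ vs ⋆ reverse vs *ₗ v) x y
    ≡⟨ lc-cong {G = G *ₗ v ⋆ vs ⋆ reverse vs} {G *ₗ v} v (⋆-reverse-inverse (G *ₗ v) vs) x y ⟩
  adj (G *ₗ v *ₗ v) x y
    ≡⟨ lc-involutive G v x y ⟩
  adj G x y ∎
  where open ≡-Reasoning

induced-lc : {f : Fin n → Fin m} → Injective _≡_ _≡_ f → ∀ {G : Graph n} {H : Graph m} v →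
  InducedVia f G H → InducedVia f (G *ₗ v) (H *ₗ f v)
induced-lc {f = f} f-inj v G⊆H x y with x ≟ y | f x ≟ f y
... | yes _    | yes _     = refl
... | yes refl | no fx≢fy  = contradiction refl fx≢fy
... | no x≢y   | yes fx≡fy = contradiction (f-inj fx≡fy) x≢y
... | no _     | no _      = cong₂ _xor_ (G⊆H x y) (cong₂ _∧_ (G⊆H v x) (G⊆H v y))

induced-⋆ : {f : Fin n → Fin m} → Injective _≡_ _≡_ f → ∀ {G : Graph n} {H : Graph m} vs →
  InducedVia f G H → InducedVia f (G ⋆ vs) (H ⋆ map f vs)
induced-⋆ f-inj []       G⊆H = G⊆H
induced-⋆ f-inj {G} {H} (v ∷ vs) G⊆H = induced-⋆ f-inj vs (induced-lc f-inj {G} {H} v G⊆H)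

AgreeOff : Fin n → Graph n → Graph n → Set
AgreeOff v G H = ∀ x y → x ≢ v → y ≢ v → x ≢ y → adj G x y ≡ adj H x y

≈G⇒agreeOff : ∀ {G H : Graph n} v → G ≈G H → AgreeOff v G H
≈G⇒agreeOff v G≈H x y _ _ _ = G≈H x y

agreeOff-refl : ∀ v (G : Graph n) → AgreeOff v G G
agreeOff-refl v G _ _ _ _ _ = refl

agreeOff-trans : ∀ {v} {G H K : Graph n} → AgreeOff v G H → AgreeOff v H K → AgreeOff v G K
agreeOff-trans G≈H H≈K x y x≢v y≢v x≢y = trans (G≈H x y x≢v y≢v x≢y) (H≈K x y x≢v y≢v x≢y)

agreeOff-lc : ∀ {v u} {G H : Graph n} → u ≢ v → AgreeOff v G H → AgreeOff v (G *ₗ u) (H *ₗ u)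
agreeOff-lc {v = v} {u} {G} {H} u≢v G≈H x y x≢v y≢v x≢y =
  begin
    adj (G *ₗ u) x y
      ≡⟨ lc-off-diagonal G u x≢y ⟩
    adj G x y xor (adj G u x ∧ adj G u y)
      ≡⟨ cong₂ _xor_ (G≈H x y x≢v y≢v x≢y) (cong₂ _∧_ (row x x≢v) (row y y≢v)) ⟩
    adj H x y xor (adj H u x ∧ adj H u y)
      ≡⟨ lc-off-diagonal H u x≢y ⟨
    adj (H *ₗ u) x y ∎
  where
  open ≡-Reasoning
  row : ∀ z → z ≢ v → adj G u z ≡ adj H u z
  row z z≢v with u ≟ z
  ... | yes refl = trans (irrefl G u) (sym (irrefl H u))
  ... | no u≢z   = G≈H u z u≢v z≢v u≢z

agreeOff-⋆ : ∀ {v} {G H : Graph n} us → All (_≢ v) us → AgreeOff v G H →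
  AgreeOff v (G ⋆ us) (H ⋆ us)
agreeOff-⋆ []       []           G≈H = G≈H
agreeOff-⋆ {G = G} {H} (u ∷ us) (u≢v ∷ us≢v) G≈H =
  agreeOff-⋆ us us≢v (agreeOff-lc {G = G} {H} u≢v G≈H)

-- Rank over GF(2)

Matrix : ℕ → Set
Matrix n = Fin n → Fin n → Bool

Perturbation : (Fin m → Set) → Matrix m → Graph m → Graph m → Set
Perturbation Q M G H = ∀ x y → Q x → Q y → x ≢ y → adj G x y ≡ adj H x y xor M x y

⊕-sum-cong : ∀ {f h : Fin s → Bool} → (∀ k → f k ≡ h k) → ⊕-sum f ≡ ⊕-sum h
⊕-sum-cong {zero}  f≗h = refl
⊕-sum-cong {suc s} f≗h = cong₂ _xor_ (f≗h zero) (⊕-sum-cong (λ k → f≗h (suc k)))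

⊕-sum-+ : ∀ (h : Fin (a + b) → Bool) →
  ⊕-sum h ≡ ⊕-sum (λ i → h (i ↑ˡ b)) xor ⊕-sum (λ j → h (a ↑ʳ j))
⊕-sum-+ {zero}  h = refl
⊕-sum-+ {suc a} h = trans (cong (h zero xor_) (⊕-sum-+ {a} (λ k → h (suc k))))
                          (sym (xor-assoc (h zero) _ _))

rank-+ : ∀ {M N : Matrix n} → RankAtMost a M → RankAtMost b N →
  RankAtMost (a + b) (λ x y → M x y xor N x y)
rank-+ {a = a} {b} (U , W , M≡UW) (U′ , W′ , N≡UW′) =
  (λ x → U x ++ᵛ U′ x) , (λ k y → (column W y ++ᵛ column W′ y) k) , λ x y →
  trans (cong₂ _xor_ (M≡UW x y) (N≡UW′ x y)) (sym (trans (⊕-sum-+ {a} _) (cong₂ _xor_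
    (⊕-sum-cong λ i → cong₂ _∧_ (lookup-++ˡ (U x) (U′ x) i) (lookup-++ˡ (column W y) (column W′ y) i))
    (⊕-sum-cong λ j → cong₂ _∧_ (lookup-++ʳ (U x) (U′ x) j) (lookup-++ʳ (column W y) (column W′ y) j)))))
  where
  column : ∀ {r} → (Fin r → Fin n → Bool) → Fin n → Fin r → Bool
  column W y k = W k y

⊕-sum-false : ⊕-sum {s} (λ _ → false) ≡ false
⊕-sum-false {zero}  = refl
⊕-sum-false {suc s} = ⊕-sum-false {s}

rank-zero : RankAtMost {n} s (λ _ _ → false)
rank-zero {s = s} = (λ _ _ → false) , (λ _ _ → false) , λ _ _ → sym (⊕-sum-false {s})

rank-mono : ∀ {M : Matrix n} → a ≤ b → RankAtMost a M → RankAtMost b M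
rank-mono {M = M} a≤b rank-M with m≤n⇒∃[o]m+o≡n a≤b
... | o , refl with rank-+ {b = o} rank-M rank-zero
... | U , W , M≡UW = U , W , λ x y → trans (sym (xor-identityʳ (M x y))) (M≡UW x y)

rank-2 : ∀ (p q r t : Fin n → Bool) → RankAtMost 2 (λ x y → (p x ∧ q y) xor (r x ∧ t y))
rank-2 p q r t = (λ x → p x ∷ᵛ r x ∷ᵛ []ᵛ) , (q ∷ᵛ t ∷ᵛ []ᵛ) , λ x y →
  cong ((p x ∧ q y) xor_) (sym (xor-identityʳ (r x ∧ t y)))

rank-restrict : ∀ (f : Fin n → Fin m) {M : Matrix m} → RankAtMost s M →
  RankAtMost s (λ i j → M (f i) (f j))
rank-restrict f (U , W , M≡UW) = (λ i → U (f i)) , (λ k j → W k (f j)) , λ i j → M≡UW (f i) (f j)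

-- Identities of local complementation by exhaustive evaluation

T-∧-split : ∀ {a b} → T (a ∧ b) → T a × T b
T-∧-split = Equivalence.to T-∧

∀ᵇ : (Bool → Bool) → Bool
∀ᵇ P = P true ∧ P false

∀ᵇ-sound : ∀ P → T (∀ᵇ P) → ∀ b → T (P b)
∀ᵇ-sound P ok true  = proj₁ (T-∧-split ok)
∀ᵇ-sound P ok false = proj₂ (T-∧-split ok)

∀ᶠ : (Fin k → Bool) → Bool
∀ᶠ {zero}  P = true
∀ᶠ {suc k} P = P zero ∧ ∀ᶠ (λ i → P (suc i))

∀ᶠ-sound : ∀ (P : Fin k → Bool) → T (∀ᶠ P) → ∀ i → T (P i)
∀ᶠ-sound P ok zero    = proj₁ (T-∧-split ok)
∀ᶠ-sound P ok (suc i) = ∀ᶠ-sound (λ i → P (suc i)) (proj₂ (T-∧-split ok)) i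

∀ᵛ : (Vector Bool k → Bool) → Bool
∀ᵛ {zero}  P = P []ᵛ
∀ᵛ {suc k} P = ∀ᵇ (λ b → ∀ᵛ (λ r → P (b ∷ᵛ r)))

-- Vectors and graphs are functions, so the soundness of a check only yields a
-- pointwise equal representative.
∀ᵛ-sound : ∀ (P : Vector Bool k → Bool) → T (∀ᵛ P) →
  ∀ (r : Vector Bool k) → Σ[ r′ ∈ Vector Bool k ] (∀ i → r′ i ≡ r i) × T (P r′)
∀ᵛ-sound {zero}  P ok r = []ᵛ , (λ ()) , ok
∀ᵛ-sound {suc k} P ok r
  with ∀ᵛ-sound (λ r′ → P (r zero ∷ᵛ r′))
                (∀ᵇ-sound (λ b → ∀ᵛ (λ r′ → P (b ∷ᵛ r′))) ok (r zero)) (tail r)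
... | r′ , r′≗r , P-ok = r zero ∷ᵛ r′ , (λ { zero → refl ; (suc i) → r′≗r i }) , P-ok

emptyGraph : Graph zero
emptyGraph = record { adj = λ () ; symm = λ () ; irrefl = λ () }

addVertex : Vector Bool k → Graph k → Graph (suc k)
addVertex r G = record { adj = edges ; symm = edges-symm ; irrefl = edges-irrefl }
  where
  edges : Fin (suc _) → Fin (suc _) → Bool
  edges zero    zero    = false
  edges zero    (suc j) = r j
  edges (suc i) zero    = r i
  edges (suc i) (suc j) = adj G i j
  edges-symm : ∀ i j → edges i j ≡ edges j i
  edges-symm zero    zero    = refl
  edges-symm zero    (suc j) = refl
  edges-symm (suc i) zero    = refl
  edges-symm (suc i) (suc j) = symm G i j
  edges-irrefl : ∀ i → edges i i ≡ false
  edges-irrefl zero    = refl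
  edges-irrefl (suc i) = irrefl G i

inducedSubgraph : Graph m → (Fin k → Fin m) → Graph k
inducedSubgraph L g = record
  { adj    = λ i j → adj L (g i) (g j)
  ; symm   = λ i j → symm L (g i) (g j)
  ; irrefl = λ i → irrefl L (g i)
  }

∀ᴳ : (Graph k → Bool) → Bool
∀ᴳ {zero}  P = P emptyGraph
∀ᴳ {suc k} P = ∀ᴳ (λ G → ∀ᵛ (λ r → P (addVertex r G)))

∀ᴳ-sound : ∀ (P : Graph k → Bool) → T (∀ᴳ P) → ∀ G → Σ[ G′ ∈ Graph k ] G′ ≈G G × T (P G′)
∀ᴳ-sound {zero}  P ok G = emptyGraph , (λ ()) , ok
∀ᴳ-sound {suc k} P ok G
  with ∀ᴳ-sound (λ G′ → ∀ᵛ (λ r → P (addVertex r G′))) ok (inducedSubgraph G suc)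
... | G′ , G′≈ , ok′ with ∀ᵛ-sound (λ r → P (addVertex r G′)) ok′ (λ j → adj G zero (suc j))
... | r , r≗ , P-ok = addVertex r G′ , same , P-ok
  where
  same : addVertex r G′ ≈G G
  same zero    zero    = sym (irrefl G zero)
  same zero    (suc j) = r≗ j
  same (suc i) zero    = trans (r≗ i) (symm G zero (suc i))
  same (suc i) (suc j) = G′≈ i j

-- A vertex seen from k named vertices: one of them, or an outside vertex
-- given by its adjacencies to them.
Position : ℕ → Set
Position k = Fin k ⊎ Vector Bool k

Locates : Graph m → (Fin k → Fin m) → Position k → Fin m → Set
Locates L g (inj₁ i) x = x ≡ g i
Locates L g (inj₂ r) x = (∀ i → g i ≢ x) × (∀ i → r i ≡ adj L (g i) x)

∀ᴾ : (Position k → Bool) → Bool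
∀ᴾ P = ∀ᶠ (λ i → P (inj₁ i)) ∧ ∀ᵛ (λ r → P (inj₂ r))

∀ᴾ-sound : ∀ (P : Position k → Bool) → T (∀ᴾ P) →
  ∀ (L : Graph m) g x → Σ[ p ∈ Position k ] Locates L g p x × T (P p)
∀ᴾ-sound P ok L g x with any? (λ i → g i ≟ x)
... | yes (i , gi≡x) = inj₁ i , sym gi≡x , ∀ᶠ-sound (λ i → P (inj₁ i)) (proj₁ (T-∧-split ok)) i
... | no ∄i with ∀ᵛ-sound (λ r → P (inj₂ r)) (proj₂ (T-∧-split ok)) (λ i → adj L (g i) x)
...   | r , r≗ , P-ok = inj₂ r , ((λ i gi≡x → ∄i (i , gi≡x)) , r≗) , P-ok

link : Graph k → Position k → Fin k → Bool
link N (inj₁ i) j = adj N j i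
link N (inj₂ r) j = r j

at : Fin k → Position k → Bool
at j (inj₁ i) = does (i ≟ j)
at j (inj₂ r) = false

coincide : Position k → Position k → Bool
coincide (inj₁ i) q = at i q
coincide (inj₂ r) q = false

lcPosition : Graph k → Fin k → Position k → Position k
lcPosition N j (inj₁ i) = inj₁ i
lcPosition N j (inj₂ r) = inj₂ (λ i → r i xor (adj N j i ∧ r j))

record View (k : ℕ) : Set where
  constructor view
  field
    named : Graph k
    first second : Position k
    edge : Bool
open View public

-- This also ranges over views of no graph (e.g. an edge bit contradicting the named
-- graph); that only makes the check stronger.
∀ⱽ : (View k → Bool) → Bool
∀ⱽ P = ∀ᴳ (λ N → ∀ᴾ (λ p → ∀ᴾ (λ q → ∀ᵇ (λ e → P (view N p q e)))))

lcView : View k → Fin k → View k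
lcView (view N p q e) j =
  view (N *ₗ j) (lcPosition N j p) (lcPosition N j q) (e xor (link N p j ∧ link N q j))

lcViews : View k → List (Fin k) → View k
lcViews = foldl lcView

record Describes (L : Graph m) (g : Fin k → Fin m) (x y : Fin m) (V : View k) : Set where
  field
    named-induced : InducedVia g (named V) L
    first-locates : Locates L g (first V) x
    second-locates : Locates L g (second V) y
    edge-adj : edge V ≡ adj L x y
open Describes public

∀ⱽ-sound : ∀ (P : View k → Bool) → T (∀ⱽ P) →
  ∀ (L : Graph m) g x y → Σ[ V ∈ View k ] Describes L g x y V × T (P V)
∀ⱽ-sound P ok L g x y
  with ∀ᴳ-sound (λ N → ∀ᴾ (λ p → ∀ᴾ (λ q → ∀ᵇ (λ e → P (view N p q e))))) ok (inducedSubgraph L g)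
... | N , N≈ , ok₁ with ∀ᴾ-sound (λ p → ∀ᴾ (λ q → ∀ᵇ (λ e → P (view N p q e)))) ok₁ L g x
... | p , p-x , ok₂ with ∀ᴾ-sound (λ q → ∀ᵇ (λ e → P (view N p q e))) ok₂ L g y
... | q , q-y , ok₃ =
  view N p q (adj L x y) ,
  record { named-induced = N≈ ; first-locates = p-x ; second-locates = q-y ; edge-adj = refl } ,
  ∀ᵇ-sound (λ e → P (view N p q e)) ok₃ (adj L x y)

module _ {L : Graph m} {g : Fin k → Fin m} where

  link-locates : ∀ {N p x} j → InducedVia g N L → Locates L g p x → link N p j ≡ adj L (g j) x
  link-locates {p = inj₁ i} j N⊆L refl     = N⊆L j i
  link-locates {p = inj₂ r} j N⊆L (_ , r≗) = r≗ j

  at-locates : Injective _≡_ _≡_ g → ∀ {p x} j → Locates L g p x → at j p ≡ does (x ≟ g j)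
  at-locates g-inj {inj₁ i} j refl with i ≟ j | g i ≟ g j
  ... | yes _    | yes _      = refl
  ... | yes refl | no gi≢gj   = contradiction refl gi≢gj
  ... | no i≢j   | yes gi≡gj  = contradiction (g-inj gi≡gj) i≢j
  ... | no _     | no _       = refl
  at-locates g-inj {inj₂ r} {x} j (outside , _) =
    sym (dec-false (x ≟ g j) (λ x≡gj → outside j (sym x≡gj)))

  coincide-locates : Injective _≡_ _≡_ g → ∀ {p q x y} → Locates L g p x → Locates L g q y → x ≢ y →
    coincide p q ≡ false
  coincide-locates g-inj {inj₁ i} {q} {y = y} refl q-y x≢y =
    trans (at-locates g-inj i q-y) (dec-false (y ≟ g i) (λ y≡x → x≢y (sym y≡x)))
  coincide-locates g-inj {inj₂ r} _ _ _ = refl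

  lcPosition-locates : ∀ {N p x} j → InducedVia g N L → Locates L g p x →
    Locates (L *ₗ g j) g (lcPosition N j p) x
  lcPosition-locates {p = inj₁ i} j N⊆L x≡gi = x≡gi
  lcPosition-locates {N} {inj₂ r} {x} j N⊆L (outside , r≗) = outside , λ i →
    trans (cong₂ (λ a b → a xor (b ∧ r j)) (r≗ i) (N⊆L j i))
          (trans (cong (λ b → adj L (g i) x xor (adj L (g j) (g i) ∧ b)) (r≗ j))
                 (sym (lc-off-diagonal L (g j) (outside i))))

describes-lc : ∀ {L : Graph m} {g : Fin k → Fin m} {x y V} → Injective _≡_ _≡_ g → x ≢ y →
  Describes L g x y V → ∀ j → Describes (L *ₗ g j) g x y (lcView V j)
describes-lc {L = L} {g} {x} {y} {view N p q e} g-inj x≢y d j = record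
  { named-induced  = induced-lc g-inj {N} {L} j (named-induced d)
  ; first-locates  = lcPosition-locates j (named-induced d) (first-locates d)
  ; second-locates = lcPosition-locates j (named-induced d) (second-locates d)
  ; edge-adj       = trans (cong₂ _xor_ (edge-adj d)
                             (cong₂ _∧_ (link-locates j (named-induced d) (first-locates d))
                                        (link-locates j (named-induced d) (second-locates d))))
                           (sym (lc-off-diagonal L (g j) x≢y))
  }

describes-⋆ : ∀ {L : Graph m} {g : Fin k → Fin m} {x y V} → Injective _≡_ _≡_ g → x ≢ y →
  Describes L g x y V → ∀ ws → Describes (L ⋆ map g ws) g x y (lcViews V ws)
describes-⋆ g-inj x≢y d []       = d
describes-⋆ g-inj x≢y d (j ∷ ws) = describes-⋆ g-inj x≢y (describes-lc g-inj x≢y d j) ws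

Constraint : ℕ → Set
Constraint k = Fin k × Fin k × Bool

Satisfies : Graph m → (Fin k → Fin m) → List (Constraint k) → Set
Satisfies L g = All (λ { (i , j , b) → adj L (g i) (g j) ≡ b })

satisfies-induced : ∀ {N : Graph k} {L : Graph m} {g} → InducedVia g N L → ∀ cs →
  Satisfies L g cs → Satisfies N (λ i → i) cs
satisfies-induced N⊆L []                 []        = []
satisfies-induced {N = N} {L} {g} N⊆L ((i , j , b) ∷ cs) (e ∷ sat) =
  trans (N⊆L i j) e ∷ satisfies-induced {N = N} {L} {g} N⊆L cs sat

-- The named vertex zero is the one off which the identities are claimed.
Admissible : List (Constraint (suc k)) → View (suc k) → Set
Admissible cs V =
  Satisfies (named V) (λ i → i) cs × at zero (first V) ≡ false × at zero (second V) ≡ false ×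
  coincide (first V) (second V) ≡ false

admissible? : ∀ cs (V : View (suc k)) → Dec (Admissible cs V)
admissible? cs V =
  all? (λ { (i , j , b) → adj (named V) i j ≟ᵇ b }) cs ×-dec (at zero (first V) ≟ᵇ false) ×-dec
  (at zero (second V) ≟ᵇ false) ×-dec (coincide (first V) (second V) ≟ᵇ false)

ViewIdentity : (lhs rhs : View (suc k) → Bool) → List (Constraint (suc k)) → Bool
ViewIdentity lhs rhs cs = ∀ⱽ (λ V → ⌊ admissible? cs V →-dec lhs V ≟ᵇ rhs V ⌋)

view-identity : ∀ (lhs rhs : View (suc k) → Bool) cs → T (ViewIdentity lhs rhs cs) →
  ∀ {L : Graph m} {g} → Injective _≡_ _≡_ g → Satisfies L g cs →
  ∀ x y → x ≢ g zero → y ≢ g zero → x ≢ y → Σ[ V ∈ View (suc k) ] Describes L g x y V × lhs V ≡ rhs V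
view-identity lhs rhs cs ok {L} {g} g-inj sat x y x≢v y≢v x≢y =
  let V , d , valid = ∀ⱽ-sound (λ V → ⌊ admissible? cs V →-dec lhs V ≟ᵇ rhs V ⌋) ok L g x y in
  V , d , toWitness {a? = admissible? cs V →-dec lhs V ≟ᵇ rhs V} valid
  ( satisfies-induced {N = named V} {L} {g} (named-induced d) cs sat
  , trans (at-locates g-inj zero (first-locates d)) (dec-false (x ≟ g zero) x≢v)
  , trans (at-locates g-inj zero (second-locates d)) (dec-false (y ≟ g zero) y≢v)
  , coincide-locates g-inj (first-locates d) (second-locates d) x≢y )

WordsAgree : List (Fin (suc k)) → List (Fin (suc k)) → List (Constraint (suc k)) → Bool
WordsAgree ws₁ ws₂ = ViewIdentity (λ V → edge (lcViews V ws₁)) (λ V → edge (lcViews V ws₂))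

agreeOff-by-check : ∀ (ws₁ ws₂ : List (Fin (suc k))) cs → T (WordsAgree ws₁ ws₂ cs) →
  ∀ {L : Graph m} {g} → Injective _≡_ _≡_ g → Satisfies L g cs →
  AgreeOff (g zero) (L ⋆ map g ws₁) (L ⋆ map g ws₂)
agreeOff-by-check ws₁ ws₂ cs ok g-inj sat x y x≢v y≢v x≢y =
  let V , d , same = view-identity (λ V → edge (lcViews V ws₁)) (λ V → edge (lcViews V ws₂)) cs ok
                                   g-inj sat x y x≢v y≢v x≢y
  in trans (sym (edge-adj (describes-⋆ g-inj x≢y d ws₁)))
           (trans same (edge-adj (describes-⋆ g-inj x≢y d ws₂)))

∷-injective : ∀ {x} {xs : Vector (Fin m) k} → (∀ i → xs i ≢ x) → Injective _≡_ _≡_ xs →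
  Injective _≡_ _≡_ (x ∷ᵛ xs)
∷-injective fresh xs-inj {zero}  {zero}  _ = refl
∷-injective fresh xs-inj {zero}  {suc j} e = contradiction (sym e) (fresh j)
∷-injective fresh xs-inj {suc i} {zero}  e = contradiction e (fresh i)
∷-injective fresh xs-inj {suc i} {suc j} e = cong suc (xs-inj e)

pair-injective : ∀ {v w : Fin m} → w ≢ v → Injective _≡_ _≡_ (v ∷ᵛ w ∷ᵛ []ᵛ)
pair-injective w≢v = ∷-injective (λ { zero → w≢v ; (suc ()) }) (∷-injective (λ ()) (λ { {()} }))

triple-injective : ∀ {v w u : Fin m} → w ≢ v → u ≢ v → u ≢ w → Injective _≡_ _≡_ (v ∷ᵛ w ∷ᵛ u ∷ᵛ []ᵛ)
triple-injective w≢v u≢v u≢w =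
  ∷-injective (λ { zero → w≢v ; (suc zero) → u≢v ; (suc (suc ())) }) (pair-injective u≢w)

adjacent⇒distinct : ∀ (L : Graph m) {v w} → adj L v w ≡ true → w ≢ v
adjacent⇒distinct L {v} vw refl with trans (sym (irrefl L v)) vw
... | ()

pivot : Graph m → Fin m → Fin m → Graph m
pivot L v w = L *ₗ v *ₗ w *ₗ v

lc-pivot : ∀ (L : Graph m) v w → pivot (L *ₗ v) v w ≈G L *ₗ w *ₗ v
lc-pivot L v w = ⋆-cong {G = L *ₗ v *ₗ v} {L} (w ∷ v ∷ []) (lc-involutive L v)

-- Below, g is the vector of vertices in the injectivity proof; words and constraints
-- refer to positions in it.
lc-comm-nonadjacent : ∀ (L : Graph m) {v u} → u ≢ v → adj L v u ≡ false →
  AgreeOff v (L *ₗ v *ₗ u) (L *ₗ u *ₗ v)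
lc-comm-nonadjacent L u≢v vu =
  agreeOff-by-check (# 0 ∷ # 1 ∷ []) (# 1 ∷ # 0 ∷ []) ((# 0 , # 1 , false) ∷ []) tt
    {L = L} (pair-injective u≢v) (vu ∷ [])

lc-adjacent-pivot : ∀ (L : Graph m) {v u} → adj L v u ≡ true →
  AgreeOff v (L *ₗ v *ₗ u) (pivot (L *ₗ u) v u)
lc-adjacent-pivot L vu =
  agreeOff-by-check (# 0 ∷ # 1 ∷ []) (# 1 ∷ # 0 ∷ # 1 ∷ # 0 ∷ []) ((# 0 , # 1 , true) ∷ []) tt
    {L = L} (pair-injective (adjacent⇒distinct L vu)) (vu ∷ [])

pivot-lc-partner : ∀ (L : Graph m) {v w} → adj L v w ≡ true →
  AgreeOff v (pivot L v w *ₗ w) (L *ₗ w *ₗ v)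
pivot-lc-partner L vw =
  agreeOff-by-check (# 0 ∷ # 1 ∷ # 0 ∷ # 1 ∷ []) (# 1 ∷ # 0 ∷ []) ((# 0 , # 1 , true) ∷ []) tt
    {L = L} (pair-injective (adjacent⇒distinct L vw)) (vw ∷ [])

pivot-lc-neighbour : ∀ (L : Graph m) {v w u} → adj L v w ≡ true → adj L v u ≡ true → u ≢ w →
  AgreeOff v (pivot L v w *ₗ u *ₗ w) (L *ₗ u *ₗ v)
pivot-lc-neighbour L vw vu u≢w =
  agreeOff-by-check (# 0 ∷ # 1 ∷ # 0 ∷ # 2 ∷ # 1 ∷ []) (# 2 ∷ # 0 ∷ [])
    ((# 0 , # 1 , true) ∷ (# 0 , # 2 , true) ∷ []) tt
    {L = L} (triple-injective (adjacent⇒distinct L vw) (adjacent⇒distinct L vu) u≢w) (vw ∷ vu ∷ [])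

pivot-lc-partner-neighbour : ∀ (L : Graph m) {v w u} → u ≢ v →
  adj L v w ≡ true → adj L v u ≡ false → adj L w u ≡ true →
  AgreeOff v (pivot L v w *ₗ u *ₗ w) (pivot (L *ₗ u) v w)
pivot-lc-partner-neighbour L u≢v vw vu wu =
  agreeOff-by-check (# 0 ∷ # 1 ∷ # 0 ∷ # 2 ∷ # 1 ∷ []) (# 2 ∷ # 0 ∷ # 1 ∷ # 0 ∷ [])
    ((# 0 , # 1 , true) ∷ (# 0 , # 2 , false) ∷ (# 1 , # 2 , true) ∷ []) tt
    {L = L} (triple-injective (adjacent⇒distinct L vw) u≢v (adjacent⇒distinct L wu)) (vw ∷ vu ∷ wu ∷ [])

pivot-lc-far : ∀ (L : Graph m) {v w u} → u ≢ v → u ≢ w →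
  adj L v w ≡ true → adj L v u ≡ false → adj L w u ≡ false →
  AgreeOff v (pivot L v w *ₗ u) (pivot (L *ₗ u) v w)
pivot-lc-far L u≢v u≢w vw vu wu =
  agreeOff-by-check (# 0 ∷ # 1 ∷ # 0 ∷ # 2 ∷ []) (# 2 ∷ # 0 ∷ # 1 ∷ # 0 ∷ [])
    ((# 0 , # 1 , true) ∷ (# 0 , # 2 , false) ∷ (# 1 , # 2 , false) ∷ []) tt
    {L = L} (triple-injective (adjacent⇒distinct L vw) u≢v u≢w) (vw ∷ vu ∷ wu ∷ [])

closedNbhd : Graph m → Fin m → Fin m → Bool
closedNbhd L w z = adj L w z xor does (z ≟ w)

pivot-perturbation : ∀ (L : Graph m) {v w} → adj L v w ≡ true → ∀ x y → x ≢ v → y ≢ v → x ≢ y →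
  adj (pivot L v w) x y ≡ adj L x y xor (adj L v x ∧ closedNbhd L w y) xor (closedNbhd L w x ∧ adj L v y)
pivot-perturbation L {v} {w} vw x y x≢v y≢v x≢y =
  conclude (view-identity lhs rhs ((# 0 , # 1 , true) ∷ []) tt {L = L} g-inj (vw ∷ [])
                          x y x≢v y≢v x≢y)
  where
  g = v ∷ᵛ w ∷ᵛ []ᵛ
  g-inj = pair-injective (adjacent⇒distinct L vw)
  closed : Graph 2 → Position 2 → Bool
  closed N p = link N p (# 1) xor at (# 1) p
  lhs rhs : View 2 → Bool
  lhs V = edge (lcViews V (# 0 ∷ # 1 ∷ # 0 ∷ []))
  rhs (view N p q e) = e xor (link N p (# 0) ∧ closed N q) xor (closed N p ∧ link N q (# 0))
  closed-locates : ∀ {N p z} → InducedVia g N L → Locates L g p z → closed N p ≡ closedNbhd L w z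
  closed-locates N⊆L p-z = cong₂ _xor_ (link-locates (# 1) N⊆L p-z) (at-locates g-inj (# 1) p-z)
  conclude : Σ[ V ∈ View 2 ] Describes L g x y V × lhs V ≡ rhs V →
    adj (pivot L v w) x y ≡ adj L x y xor (adj L v x ∧ closedNbhd L w y) xor (closedNbhd L w x ∧ adj L v y)
  conclude (V , d , same) = begin
    adj (pivot L v w) x y ≡⟨ edge-adj (describes-⋆ g-inj x≢y d (# 0 ∷ # 1 ∷ # 0 ∷ [])) ⟨
    lhs V                 ≡⟨ same ⟩
    rhs V                 ≡⟨ cong₂ _xor_ (edge-adj d) (cong₂ _xor_
                               (cong₂ _∧_ (link-locates (# 0) N⊆L x-at) (closed-locates N⊆L y-at))
                               (cong₂ _∧_ (closed-locates N⊆L x-at) (link-locates (# 0) N⊆L y-at))) ⟩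
    adj L x y xor (adj L v x ∧ closedNbhd L w y) xor (closedNbhd L w x ∧ adj L v y) ∎
    where
    open ≡-Reasoning
    N⊆L = named-induced d
    x-at = first-locates d
    y-at = second-locates d

-- Bouchet's lemma

data Move (P : Fin m → Set) (L : Graph m) (v : Fin m) : Set where
  stay complement : Move P L v
  pivotWith : ∀ w → P w → adj L v w ≡ true → Move P L v

applyMove : ∀ {P} {L : Graph m} {v} → Move P L v → Graph m
applyMove {L = L}     stay              = L
applyMove {L = L} {v} complement        = L *ₗ v
applyMove {L = L} {v} (pivotWith w _ _) = pivot L v w

move-rank : ∀ {P} {L : Graph m} {v} (e : Move P L v) →
  Σ[ M ∈ Matrix m ] RankAtMost 2 M × Perturbation (_≢ v) M (applyMove e) L
move-rank {L = L} stay = (λ _ _ → false) , rank-zero , λ x y _ _ _ → sym (xor-identityʳ (adj L x y))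
move-rank {L = L} {v} complement =
  _ , rank-2 (adj L v) (adj L v) (λ _ → false) (λ _ → false) , λ x y _ _ x≢y →
  trans (lc-off-diagonal L v x≢y) (cong (adj L x y xor_) (sym (xor-identityʳ (adj L v x ∧ adj L v y))))
move-rank {L = L} {v} (pivotWith w _ vw) =
  _ , rank-2 (adj L v) (closedNbhd L w) (closedNbhd L w) (adj L v) , pivot-perturbation L vw

Avoiding : (Fin m → Set) → Fin m → Fin m → Set
Avoiding P v z = P z × z ≢ v

-- The invariant of Bouchet's lemma: off v, the current graph L followed by one move
-- at v is reached from K without complementing at v.
record Reduction (P : Fin m → Set) (v : Fin m) (K L : Graph m) : Set where
  constructor reduction
  field
    sequence : List (Fin m)
    allowed : All (Avoiding P v) sequence
    move : Move P L v
    agrees : AgreeOff v (K ⋆ sequence) (applyMove move)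

reduction-start : ∀ {P v} (K : Graph m) → Reduction P v K K
reduction-start {v = v} K = reduction [] [] stay (agreeOff-refl v K)

reduction-extend : ∀ {P v} {K L L′ : Graph m} (r : Reduction P v K L) →
  ∀ xs → All (Avoiding P v) xs → (e : Move P L′ v) →
  AgreeOff v (applyMove (Reduction.move r) ⋆ xs) (applyMove e) → Reduction P v K L′
reduction-extend {v = v} {K} (reduction ρ ρ-ok e₀ agr) xs xs-ok e agr′ =
  reduction (ρ ++ xs) (++⁺ ρ-ok xs-ok) e
    (subst (λ G → AgreeOff v G (applyMove e)) (sym (⋆-++ K ρ xs))
      (agreeOff-trans {G = K ⋆ ρ ⋆ xs} {applyMove e₀ ⋆ xs} {applyMove e}
        (agreeOff-⋆ {G = K ⋆ ρ} xs (All.map proj₂ xs-ok) agr) agr′))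

reduction-lc-self : ∀ {P v} {K L : Graph m} → Reduction P v K L → Reduction P v K (L *ₗ v)
reduction-lc-self {v = v} {L = L} r@(reduction _ _ stay _) =
  reduction-extend r [] [] complement
    (≈G⇒agreeOff {G = L} {L *ₗ v *ₗ v} v (λ x y → sym (lc-involutive L v x y)))
reduction-lc-self {v = v} {L = L} r@(reduction _ _ complement _) =
  reduction-extend r [] [] stay (agreeOff-refl v (L *ₗ v))
reduction-lc-self {v = v} {L = L} r@(reduction _ _ (pivotWith w pw vw) _) =
  reduction-extend r [ w ] ((pw , adjacent⇒distinct L vw) ∷ [])
    (pivotWith w pw (trans (lc-row L v w) vw))
    (agreeOff-trans {G = pivot L v w *ₗ w} {L *ₗ w *ₗ v} {pivot (L *ₗ v) v w}
      (pivot-lc-partner L vw)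
      (≈G⇒agreeOff {G = L *ₗ w *ₗ v} {pivot (L *ₗ v) v w} v (λ x y → sym (lc-pivot L v w x y))))

reduction-lc-other : ∀ {P v u} {K L : Graph m} → u ≢ v → P u → Reduction P v K L →
  Reduction P v K (L *ₗ u)
reduction-lc-other {v = v} {u} {L = L} u≢v pu r@(reduction _ _ stay _) =
  reduction-extend r [ u ] ((pu , u≢v) ∷ []) stay (agreeOff-refl v (L *ₗ u))
reduction-lc-other {v = v} {u} {L = L} u≢v pu r@(reduction _ _ complement _) with adj L v u in vu
... | false = reduction-extend r [ u ] ((pu , u≢v) ∷ []) complement (lc-comm-nonadjacent L u≢v vu)
... | true  = reduction-extend r [ u ] ((pu , u≢v) ∷ []) (pivotWith u pu vu′) (lc-adjacent-pivot L vu)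
  where
  vu′ : adj (L *ₗ u) v u ≡ true
  vu′ = trans (symm (L *ₗ u) v u) (trans (lc-row L u v) (trans (symm L u v) vu))
reduction-lc-other {v = v} {u} {L = L} u≢v pu r@(reduction _ _ (pivotWith w pw vw) _) with u ≟ w
... | yes refl = reduction-extend r [ u ] ((pu , u≢v) ∷ []) complement (pivot-lc-partner L vw)
... | no u≢w with adj L v u in vu | adj L w u in wu
...   | true  | _     =
  reduction-extend r (u ∷ w ∷ []) ((pu , u≢v) ∷ (pw , adjacent⇒distinct L vw) ∷ []) complement
    (pivot-lc-neighbour L vw vu u≢w)
...   | false | true  =
  reduction-extend r (u ∷ w ∷ []) ((pu , u≢v) ∷ (pw , adjacent⇒distinct L vw) ∷ [])
    (pivotWith w pw (trans (lc-nonneighbour L vu (≢-sym (adjacent⇒distinct L vw))) vw))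
    (pivot-lc-partner-neighbour L u≢v vw vu wu)
...   | false | false =
  reduction-extend r [ u ] ((pu , u≢v) ∷ [])
    (pivotWith w pw (trans (lc-nonneighbour L vu (≢-sym (adjacent⇒distinct L vw))) vw))
    (pivot-lc-far L u≢v u≢w vw vu wu)

reduction-⋆ : ∀ {P v} {K L : Graph m} {σ} → Reduction P v K L → All P σ → Reduction P v K (L ⋆ σ)
reduction-⋆         r []                  = r
reduction-⋆ {v = v} r (_∷_ {u} pu pσ) with u ≟ v
... | yes refl = reduction-⋆ (reduction-lc-self r) pσ
... | no u≢v   = reduction-⋆ (reduction-lc-other u≢v pu r) pσ

delete-vertex : ∀ {P : Fin m → Set} v (K : Graph m) {σ} → All P σ →
  Σ[ ρ ∈ List (Fin m) ] All (Avoiding P v) ρ ×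
  Σ[ M ∈ Matrix m ] RankAtMost 2 M × Perturbation (_≢ v) M (K ⋆ ρ) (K ⋆ σ)
delete-vertex v K σ-ok =
  let reduction ρ ρ-ok e agr = reduction-⋆ (reduction-start K) σ-ok
      M , rank-M , e≈σ = move-rank e
  in ρ , ρ-ok , M , rank-M , λ x y x≢v y≢v x≢y → trans (agr x y x≢v y≢v x≢y) (e≈σ x y x≢v y≢v x≢y)

delete-vertices : ∀ (Ys : List (Fin m)) (K : Graph m) σ →
  Σ[ τ ∈ List (Fin m) ] All (_∉ Ys) τ ×
  Σ[ M ∈ Matrix m ] RankAtMost (2 * length Ys) M × Perturbation (_∉ Ys) M (K ⋆ τ) (K ⋆ σ)
delete-vertices [] K σ =
  σ , All.universal (λ _ ()) σ , (λ _ _ → false) , rank-zero , λ x y _ _ _ → sym (xor-identityʳ _)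
delete-vertices (v ∷ Ys) K σ =
  let τ , τ-ok , M , rank-M , τ≈σ = delete-vertices Ys K σ
      ρ , ρ-ok , R , rank-R , ρ≈τ = delete-vertex v K τ-ok
  in ρ , All.map (λ (z∉Ys , z≢v) → λ { (here z≡v) → z≢v z≡v ; (there z∈Ys) → z∉Ys z∈Ys }) ρ-ok ,
     (λ x y → R x y xor M x y) ,
     subst (λ s → RankAtMost s (λ x y → R x y xor M x y)) (sym (*-suc 2 (length Ys)))
           (rank-+ rank-R rank-M) ,
     λ x y x∉ y∉ x≢y → begin
       adj (K ⋆ ρ) x y
         ≡⟨ ρ≈τ x y (x∉ ∘ here) (y∉ ∘ here) x≢y ⟩
       adj (K ⋆ τ) x y xor R x y
         ≡⟨ cong (_xor R x y) (τ≈σ x y (x∉ ∘ there) (y∉ ∘ there) x≢y) ⟩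
       (adj (K ⋆ σ) x y xor M x y) xor R x y
         ≡⟨ xor-assoc (adj (K ⋆ σ) x y) (M x y) (R x y) ⟩
       adj (K ⋆ σ) x y xor (M x y xor R x y)
         ≡⟨ cong (adj (K ⋆ σ) x y xor_) (xor-comm (M x y) (R x y)) ⟩
       adj (K ⋆ σ) x y xor (R x y xor M x y) ∎
  where open ≡-Reasoning

-- Vertices outside the image of an injection

lookup-injective : ∀ {A : Set} {xs : List A} → Unique xs → Injective _≡_ _≡_ (lookup xs)
lookup-injective (_ ∷ _)      {zero}  {zero}  _  = refl
lookup-injective (x∉xs ∷ _)   {zero}  {suc j} eq = contradiction eq (All.lookup x∉xs (∈-lookup j))
lookup-injective (x∉xs ∷ _)   {suc i} {zero}  eq = contradiction (sym eq) (All.lookup x∉xs (∈-lookup i))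
lookup-injective (_ ∷ unique) {suc i} {suc j} eq = cong suc (lookup-injective unique eq)

unique⇒length≤ : ∀ {xs : List (Fin m)} → Unique xs → length xs ≤ m
unique⇒length≤ unique = injective⇒≤ (lookup-injective unique)

outsideImage : (Fin n → Fin m) → List (Fin m)
outsideImage f = filter (λ z → ¬? (any? (λ i → f i ≟ z))) (allFin _)

image∉outsideImage : ∀ (f : Fin n → Fin m) i → f i ∉ outsideImage f
image∉outsideImage f i fi∈ =
  proj₂ (∈-filter⁻ (λ z → ¬? (any? (λ i → f i ≟ z))) {xs = allFin _} fi∈) (i , refl)

∉outsideImage⇒image : ∀ (f : Fin n → Fin m) {z} → z ∉ outsideImage f → ∃[ i ] f i ≡ z
∉outsideImage⇒image f {z} z∉ with any? (λ i → f i ≟ z)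
... | yes found = found
... | no ∄i     = contradiction (∈-filter⁺ (λ z → ¬? (any? (λ i → f i ≟ z))) (∈-allFin z) ∄i) z∉

length-outsideImage : ∀ {t} {f : Fin n → Fin (n + t)} → Injective _≡_ _≡_ f →
  length (outsideImage f) ≤ t
length-outsideImage {n} {t} {f} f-inj = +-cancelˡ-≤ n _ _ (subst (_≤ n + t) length-image+outside
  (unique⇒length≤ (Unique.++⁺ (Unique.tabulate⁺ f-inj) (Unique.filter⁺ _ (Unique.allFin⁺ _)) disjoint)))
  where
  length-image+outside : length (tabulate f ++ outsideImage f) ≡ n + length (outsideImage f)
  length-image+outside =
    trans (length-++ (tabulate f)) (cong (_+ length (outsideImage f)) (length-tabulate f))
  disjoint : ∀ {z} → ¬ (z ∈ tabulate f × z ∈ outsideImage f)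
  disjoint (z∈image , z∈outside) with ∈-tabulate⁻ z∈image
  ... | i , refl = image∉outsideImage f i z∈outside

preimage : ∀ (f : Fin n → Fin m) {τ} → All (λ z → ∃[ i ] f i ≡ z) τ →
  Σ[ τ′ ∈ List (Fin n) ] map f τ′ ≡ τ
preimage f []              = [] , refl
preimage f ((i , refl) ∷ ps) with preimage f ps
... | τ′ , refl = i ∷ τ′ , refl

vertexMinors⇒induced : ∀ {f : Fin n → Fin m} {G₁ G₂ : Graph n} {H : Graph m} →
  VertexMinorVia f G₁ H → VertexMinorVia f G₂ H →
  Σ[ K ∈ Graph m ] InducedVia f G₁ K × Σ[ σ ∈ List (Fin m) ] InducedVia f G₂ (K ⋆ σ)
vertexMinors⇒induced {f = f} {G₁} {G₂} {H}
  (H₁ , (vs₁ , H⋆vs₁≈H₁) , G₁⊆H₁) (H₂ , (vs₂ , H⋆vs₂≈H₂) , G₂⊆H₂) =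
  H ⋆ vs₁ , (λ i j → trans (G₁⊆H₁ i j) (sym (H⋆vs₁≈H₁ (f i) (f j)))) ,
  reverse vs₁ ++ vs₂ , λ i j → begin
    adj G₂ i j
      ≡⟨ G₂⊆H₂ i j ⟩
    adj H₂ (f i) (f j)
      ≡⟨ H⋆vs₂≈H₂ (f i) (f j) ⟨
    adj (H ⋆ vs₂) (f i) (f j)
      ≡⟨ ⋆-cong {G = H ⋆ vs₁ ⋆ reverse vs₁} {H} vs₂ (⋆-reverse-inverse H vs₁) (f i) (f j) ⟨
    adj (H ⋆ vs₁ ⋆ reverse vs₁ ⋆ vs₂) (f i) (f j)
      ≡⟨ cong (λ L → adj L (f i) (f j)) (⋆-++ (H ⋆ vs₁) (reverse vs₁) vs₂) ⟨
    adj (H ⋆ vs₁ ⋆ (reverse vs₁ ++ vs₂)) (f i) (f j) ∎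
  where open ≡-Reasoning

induced-perturbation : ∀ {f : Fin n → Fin m} → Injective _≡_ _≡_ f →
  ∀ {Q : Fin m → Set} → (∀ i → Q (f i)) →
  ∀ {G₁ G₂ : Graph n} {A B : Graph m} {M} → InducedVia f G₁ A → InducedVia f G₂ B →
  Perturbation Q M A B →
  ∀ i j → i ≢ j → adj G₁ i j ≡ adj G₂ i j xor M (f i) (f j)
induced-perturbation {f = f} f-inj Q-image {M = M} G₁⊆A G₂⊆B A≈B+M i j i≢j =
  trans (G₁⊆A i j) (trans (A≈B+M (f i) (f j) (Q-image i) (Q-image j) (λ fi≡fj → i≢j (f-inj fi≡fj)))
                          (cong (_xor M (f i) (f j)) (sym (G₂⊆B i j))))

lemma7p2 : ∀ (n t : ℕ) (G G₁ : Graph n) → TPerturbation t G₁ G →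
    ∃[ G₃ ] (LocallyEquivalent G₁ G₃ × RankPerturbation (2 * t) G₃ G)
lemma7p2 n t G G₁ (H , f , f-inj , G₁≺H , G≺H) =
  let K , G₁⊆K , σ , G⊆K⋆σ = vertexMinors⇒induced {f = f} {G₁} {G} {H} G₁≺H G≺H
      τ , τ-ok , M , rank-M , τ≈σ+M = delete-vertices (outsideImage f) K σ
      τ′ , f[τ′]≡τ = preimage f (All.map (∉outsideImage⇒image f) τ-ok)
      G₁⋆τ′⊆K⋆τ = subst (λ vs → InducedVia f (G₁ ⋆ τ′) (K ⋆ vs)) f[τ′]≡τ
                        (induced-⋆ f-inj {G₁} {K} τ′ G₁⊆K)
  in G₁ ⋆ τ′ , (τ′ , λ _ _ → refl) , (λ i j → M (f i) (f j)) ,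
     rank-mono (*-monoʳ-≤ 2 (length-outsideImage f-inj)) (rank-restrict f rank-M) ,
     induced-perturbation f-inj (image∉outsideImage f) {G₁ ⋆ τ′} {G} {K ⋆ τ} {K ⋆ σ}
       G₁⋆τ′⊆K⋆τ G⊆K⋆σ τ≈σ+M
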